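{- Let $T$ be a simple tree, let $k$ be at least the maximum degree of $T$, and let $f:G\to T^{(k)}$ be a covering projection. If $G$ contains a cycle of length 4 (a $C_4$) as a subgraph, then at least one pair of opposite edges of this $C_4$ is mapped by $f$ onto semi-edges.
   Context: Graphs may contain multiple edges, loops and semi-edges (links with a single endpoint, contributing 1 to the degree). For a simple tree $T$ and $k$ at least its maximum degree, $T^{(k)}$ is the $k$-regular graph obtained from $T$ by attaching $k-\deg_T(u)$ semi-edges to each vertex $u$. A covering projection $f:G\to H$ maps vertices to vertices and links to links such that the preimage of each edge $uv$ of $H$ is a perfect matching between $f^{ -1}(u)$ and $f^{ -1}(v)$, the preimage of each loop at $u$ is a disjoint union of cycles spanning $f^{ -1}(u)$, and the preimage of each semi-edge at $u$ is a disjoint union of edges and semi-edges spanning $f^{ -1}(u)$. -}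

module Defs where

open import Data.Nat using (ℕ; zero; suc; _+_; _∸_; _≤_)
open import Data.Fin using (Fin; _≟_; inject₁; fromℕ) renaming (zero to fz; suc to fs)
open import Data.List using (List; length; lookup; _++_; concatMap; replicate; allFin; map)
open import Data.Nat.ListAction using (sum)
open import Data.Product using (Σ; _×_; ∃)
open import Data.Sum using (_⊎_)
open import Data.Unit using (⊤)
open import Data.Empty using (⊥)
open import Data.Bool using (if_then_else_)
open import Relation.Nullary using (¬_; does; Dec; yes; no)
open import Relation.Binary.PropositionalEquality using (_≡_; _≢_)
open import Function.Definitions using (Injective)

-- Graphs with multiple edges, loops and semi-edges.
-- A link is either an edge with two endpoints (a loop when they coincide)
-- or a semi-edge with a single endpoint.

data Link (V : Set) : Set where
  edge : V → V → Link V
  semi : V → Link V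

record Graph : Set where
  constructor mkGraph
  field
    nV    : ℕ
    links : List (Link (Fin nV))

open Graph public

V : Graph → Set
V G = Fin (nV G)

L : Graph → Set
L G = Fin (length (links G))

lnk : (G : Graph) → L G → Link (V G)
lnk G = lookup (links G)

-- number of ends of a link at a vertex (a loop contributes 2, a semi-edge 1)
δ : {n : ℕ} → Fin n → Fin n → ℕ
δ a x = if does (a ≟ x) then 1 else 0

ends : {n : ℕ} → Link (Fin n) → Fin n → ℕ
ends (edge a b) x = δ a x + δ b x
ends (semi a)   x = δ a x

deg : (G : Graph) → V G → ℕ
deg G x = sum (map (λ l → ends l x) (links G))

IsSemi : {W : Set} → Link W → Set
IsSemi (edge _ _) = ⊥
IsSemi (semi _)   = ⊤

EdgeBetween : {W : Set} → Link W → W → W → Set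
EdgeBetween (edge c d) a b = (c ≡ a × d ≡ b) ⊎ (c ≡ b × d ≡ a)
EdgeBetween (semi _)   a b = ⊥

Adj : (G : Graph) → V G → V G → Set
Adj G u v = ∃ λ (i : L G) → EdgeBetween (lnk G i) u v

data Walk (G : Graph) : V G → V G → Set where
  here : ∀ {u} → Walk G u u
  step : ∀ {u v w} → Adj G u v → Walk G v w → Walk G u w

Connected : Graph → Set
Connected G = ∀ u v → Walk G u v

-- a cycle of length m + 3: distinct vertices c 0, …, c (m+2), consecutive adjacent
record Cycle (G : Graph) (m : ℕ) : Set where
  field
    c     : Fin (suc (suc (suc m))) → V G
    inj   : Injective _≡_ _≡_ c
    adj   : ∀ (i : Fin (suc (suc m))) → Adj G (c (inject₁ i)) (c (fs i))
    close : Adj G (c (fromℕ (suc (suc m)))) (c fz)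

Acyclic : Graph → Set
Acyclic G = ∀ m → ¬ Cycle G m

Simple : Graph → Set
Simple G =
  (∀ (i : L G) → Σ (V G) λ a → Σ (V G) λ b → a ≢ b × lnk G i ≡ edge a b)
  × (∀ (i j : L G) (a b : V G) → EdgeBetween (lnk G i) a b → EdgeBetween (lnk G j) a b → i ≡ j)

record SimpleTree (T : Graph) : Set where
  field
    simple    : Simple T
    connected : Connected T
    acyclic   : Acyclic T

MaxDegreeAtMost : Graph → ℕ → Set
MaxDegreeAtMost T k = ∀ (u : V T) → deg T u ≤ k

_^⁽_⁾ : Graph → ℕ → Graph
T ^⁽ k ⁾ = mkGraph (nV T)
  (links T ++ concatMap (λ u → replicate (k ∸ deg T u) (semi u)) (allFin (nV T)))

LinkHom : {A B : Set} → (A → B) → Link A → Link B → Set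
LinkHom f (edge a b) (edge c d) = (f a ≡ c × f b ≡ d) ⊎ (f a ≡ d × f b ≡ c)
LinkHom f (edge a b) (semi c)   = f a ≡ c × f b ≡ c
LinkHom f (semi a)   (edge c d) = ⊥
LinkHom f (semi a)   (semi c)   = f a ≡ c

preDeg : (G H : Graph) → (L G → L H) → L H → V G → ℕ
preDeg G H fL h x =
  sum (map (λ e → if does (fL e ≟ h) then ends (lnk G e) x else 0) (allFin (length (links G))))

-- condition on the preimage of one link h of H
-- * edge uv (u ≠ v): perfect matching between f⁻¹(u) and f⁻¹(v)
--   (preimage links join the two fibres by LinkHom; every vertex of both fibres has degree 1)
-- * loop at u: disjoint union of cycles spanning f⁻¹(u) (2-regular spanning subgraph of the fibre)
-- * semi-edge at u: disjoint union of edges and semi-edges spanning f⁻¹(u) (1-regular)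
PreimageCond : (G H : Graph) → (V G → V H) → (L G → L H) → L H → Set
PreimageCond G H fV fL h = go (lnk H h)
  where
  edgeCase : (u v : V H) → Dec (u ≡ v) → Set
  edgeCase u v (yes _) = ∀ x → fV x ≡ u → preDeg G H fL h x ≡ 2
  edgeCase u v (no _)  = ∀ x → (fV x ≡ u ⊎ fV x ≡ v) → preDeg G H fL h x ≡ 1
  go : Link (V H) → Set
  go (edge u v) = edgeCase u v (u ≟ v)
  go (semi u)   = ∀ x → fV x ≡ u → preDeg G H fL h x ≡ 1

record CoveringProjection (G H : Graph) : Set where
  field
    fV   : V G → V H
    fL   : L G → L H
    hom  : ∀ (e : L G) → LinkHom fV (lnk G e) (lnk H (fL e))
    cond : ∀ (h : L H) → PreimageCond G H fV fL h

next4 : Fin 4 → Fin 4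
next4 fz                = fs fz
next4 (fs fz)           = fs (fs fz)
next4 (fs (fs fz))      = fs (fs (fs fz))
next4 (fs (fs (fs fz))) = fz

record C4 (G : Graph) : Set where
  field
    v     : Fin 4 → V G
    e     : Fin 4 → L G
    v-inj : Injective _≡_ _≡_ v
    e-inj : Injective _≡_ _≡_ e
    inc   : ∀ i → EdgeBetween (lnk G (e i)) (v i) (v (next4 i))

{-# OPTIONS --safe #-}
module Submission where

-- Each edge of the 4-cycle is mapped either onto a semi-edge, collapsing its two ends to one
-- vertex of T, or onto an edge of T. Since a covering is a local bijection and T has no parallel
-- edges, two consecutive edges of the cycle mapped onto edges of T cannot backtrack, so their
-- images form a path of length two in T. The images of the remaining two edges would join its
-- distinct ends by a walk of length one or two, closing a triangle or a 4-cycle in the tree.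
-- Hence of any two consecutive edges one is mapped onto a semi-edge, and such a set of edges of
-- a 4-cycle contains an opposite pair.

open import Defs
open import Data.Nat using (ℕ; _+_; _∸_; _≤_)
open import Data.Nat.Properties using (≤-trans; ≤-reflexive; m≤m+n; m≤n+m; +-monoʳ-≤; +-mono-≤; +-comm; <-irrefl)
open import Data.Fin using (Fin; _≟_) renaming (zero to fz; suc to fs)
open import Data.Fin.Properties using (0≢1+n; suc-injective)
open import Data.List using (List; []; _∷_; _++_; lookup; tabulate; concatMap; replicate; allFin)
open import Data.List.Properties using (map-tabulate)
open import Data.List.Relation.Unary.All as All using (All)
open import Data.List.Relation.Unary.All.Properties using (concat⁺; map⁺; replicate⁺)
open import Data.List.Membership.Propositional.Properties using (∈-lookup)
open import Data.Nat.ListAction using (sum)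
open import Data.Vec as Vec using (_∷_; [])
open import Data.Vec.Relation.Unary.AllPairs using (_∷_; [])
open import Data.Vec.Relation.Unary.All using (_∷_; [])
open import Data.Vec.Relation.Unary.Unique.Propositional using (Unique)
open import Data.Vec.Relation.Unary.Unique.Propositional.Properties using (lookup-injective)
open import Data.Product using (_×_; _,_; ∃; proj₁)
open import Data.Sum using (_⊎_; inj₁; inj₂)
open import Data.Unit using (tt)
open import Data.Empty using (⊥; ⊥-elim)
open import Function using (_∘_; id)
open import Data.Bool using (if_then_else_)
open import Relation.Nullary using (¬_; yes; no; does)
open import Relation.Nullary.Decidable using (dec-true)
open import Relation.Binary.PropositionalEquality

module _ {A : Set} (P : A → Set) where

  lookup-++⁻ˡ : ∀ xs {ys} → All (¬_ ∘ P) ys → ∀ h → P (lookup (xs ++ ys) h) → ∃ λ j → P (lookup xs j)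
  lookup-++⁻ˡ []       ¬Pys h      p = ⊥-elim (All.lookup ¬Pys (∈-lookup h) p)
  lookup-++⁻ˡ (x ∷ xs) ¬Pys fz     p = fz , p
  lookup-++⁻ˡ (x ∷ xs) ¬Pys (fs h) p = let j , q = lookup-++⁻ˡ xs ¬Pys h p in fs j , q

  lookup-++-unique : ∀ xs {ys} → All (¬_ ∘ P) ys →
    (∀ i j → P (lookup xs i) → P (lookup xs j) → i ≡ j) →
    ∀ h₁ h₂ → P (lookup (xs ++ ys) h₁) → P (lookup (xs ++ ys) h₂) → h₁ ≡ h₂
  lookup-++-unique []       ¬Pys unique h₁ h₂ p₁ p₂ = ⊥-elim (All.lookup ¬Pys (∈-lookup h₁) p₁)
  lookup-++-unique (x ∷ xs) ¬Pys unique fz fz p₁ p₂ = refl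
  lookup-++-unique (x ∷ xs) ¬Pys unique fz (fs h₂) p₁ p₂ =
    let j , q = lookup-++⁻ˡ xs ¬Pys h₂ p₂ in ⊥-elim (0≢1+n (unique fz (fs j) p₁ q))
  lookup-++-unique (x ∷ xs) ¬Pys unique (fs h₁) fz p₁ p₂ =
    let j , q = lookup-++⁻ˡ xs ¬Pys h₁ p₁ in ⊥-elim (0≢1+n (unique fz (fs j) p₂ q))
  lookup-++-unique (x ∷ xs) ¬Pys unique (fs h₁) (fs h₂) p₁ p₂ =
    cong fs (lookup-++-unique xs ¬Pys (λ i j p q → suc-injective (unique (fs i) (fs j) p q)) h₁ h₂ p₁ p₂)

≤sum-tabulate : ∀ {n} (g : Fin n → ℕ) i → g i ≤ sum (tabulate g)
≤sum-tabulate g fz     = m≤m+n _ _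
≤sum-tabulate g (fs i) = ≤-trans (≤sum-tabulate (g ∘ fs) i) (m≤n+m _ _)

+≤sum-tabulate : ∀ {n} (g : Fin n → ℕ) {i j} → i ≢ j → g i + g j ≤ sum (tabulate g)
+≤sum-tabulate g {fz}   {fz}   i≢j = ⊥-elim (i≢j refl)
+≤sum-tabulate g {fz}   {fs j} i≢j = +-monoʳ-≤ (g fz) (≤sum-tabulate (g ∘ fs) j)
+≤sum-tabulate g {fs i} {fz}   i≢j =
  subst (_≤ sum (tabulate g)) (+-comm (g fz) (g (fs i))) (+-monoʳ-≤ (g fz) (≤sum-tabulate (g ∘ fs) i))
+≤sum-tabulate g {fs i} {fs j} i≢j =
  ≤-trans (+≤sum-tabulate (g ∘ fs) (i≢j ∘ cong fs)) (m≤n+m _ _)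

δ-refl : ∀ {n} (a : Fin n) → δ a a ≡ 1
δ-refl a rewrite dec-true (a ≟ a) refl = refl

edgeBetween⇒1≤ends : ∀ {n} (l : Link (Fin n)) {a b} → EdgeBetween l a b → 1 ≤ ends l a
edgeBetween⇒1≤ends (edge c d) (inj₁ (refl , _)) = ≤-trans (≤-reflexive (sym (δ-refl c))) (m≤m+n _ _)
edgeBetween⇒1≤ends (edge c d) (inj₂ (_ , refl)) = ≤-trans (≤-reflexive (sym (δ-refl d))) (m≤n+m _ _)

edgeBetween-sym : ∀ {W : Set} (l : Link W) {a b} → EdgeBetween l a b → EdgeBetween l b a
edgeBetween-sym (edge c d) (inj₁ p) = inj₂ p
edgeBetween-sym (edge c d) (inj₂ p) = inj₁ p

linkHom-edgeBetween : ∀ {A B : Set} (g : A → B) (l : Link A) (l′ : Link B) {x y} →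
  EdgeBetween l x y → LinkHom g l l′ → (IsSemi l′ × g x ≡ g y) ⊎ EdgeBetween l′ (g x) (g y)
linkHom-edgeBetween g (edge c d) (edge p q) (inj₁ (refl , refl)) (inj₁ (gc , gd)) = inj₂ (inj₁ (sym gc , sym gd))
linkHom-edgeBetween g (edge c d) (edge p q) (inj₁ (refl , refl)) (inj₂ (gc , gd)) = inj₂ (inj₂ (sym gd , sym gc))
linkHom-edgeBetween g (edge c d) (edge p q) (inj₂ (refl , refl)) (inj₁ (gc , gd)) = inj₂ (inj₂ (sym gc , sym gd))
linkHom-edgeBetween g (edge c d) (edge p q) (inj₂ (refl , refl)) (inj₂ (gc , gd)) = inj₂ (inj₁ (sym gd , sym gc))
linkHom-edgeBetween g (edge c d) (semi s)   (inj₁ (refl , refl)) (gc , gd) = inj₁ (tt , trans gc (sym gd))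
linkHom-edgeBetween g (edge c d) (semi s)   (inj₂ (refl , refl)) (gc , gd) = inj₁ (tt , trans gd (sym gc))

2≤preDeg : ∀ (G H : Graph) (fL : L G → L H) {h x g₁ g₂} → g₁ ≢ g₂ → fL g₁ ≡ h → fL g₂ ≡ h →
  1 ≤ ends (lnk G g₁) x → 1 ≤ ends (lnk G g₂) x → 2 ≤ preDeg G H fL h x
2≤preDeg G H fL {h} {x} {g₁} {g₂} g₁≢g₂ fg₁ fg₂ x∈g₁ x∈g₂ =
  subst (2 ≤_) (sym (cong sum (map-tabulate id F)))
    (≤-trans (+-mono-≤ (counted fg₁ x∈g₁) (counted fg₂ x∈g₂)) (+≤sum-tabulate F g₁≢g₂))
  where
  F : L G → ℕ
  F e = if does (fL e ≟ h) then ends (lnk G e) x else 0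
  counted : ∀ {g} → fL g ≡ h → 1 ≤ ends (lnk G g) x → 1 ≤ F g
  counted {g} fg x∈g rewrite dec-true (fL g ≟ h) fg = x∈g

module _ {G H : Graph} (f : CoveringProjection G H) where
  open CoveringProjection f

  preDeg-edge≡1 : ∀ {h a b x} → a ≢ b → EdgeBetween (lnk H h) a b → fV x ≡ a → preDeg G H fL h x ≡ 1
  preDeg-edge≡1 {h} {x = x} a≢b ab fx with lnk H h | cond h | ab
  ... | edge c d | cond-h | ab′ with c ≟ d | cond-h | ab′
  ...   | yes c≡d | _      | inj₁ (refl , refl) = ⊥-elim (a≢b c≡d)
  ...   | yes c≡d | _      | inj₂ (refl , refl) = ⊥-elim (a≢b (sym c≡d))
  ...   | no _    | cond′ | inj₁ (refl , refl) = cond′ x (inj₁ fx)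
  ...   | no _    | cond′ | inj₂ (refl , refl) = cond′ x (inj₂ fx)

  covering-locally-injective : ∀ {h a b x g₁ g₂} → a ≢ b → EdgeBetween (lnk H h) a b → fV x ≡ a →
    fL g₁ ≡ h → fL g₂ ≡ h → 1 ≤ ends (lnk G g₁) x → 1 ≤ ends (lnk G g₂) x → g₁ ≡ g₂
  covering-locally-injective {g₁ = g₁} {g₂} a≢b ab fx fg₁ fg₂ x∈g₁ x∈g₂ with g₁ ≟ g₂
  ... | yes g₁≡g₂ = g₁≡g₂
  ... | no g₁≢g₂ = ⊥-elim (<-irrefl refl
        (subst (2 ≤_) (preDeg-edge≡1 a≢b ab fx) (2≤preDeg G H fL g₁≢g₂ fg₁ fg₂ x∈g₁ x∈g₂)))

attachedSemis : (T : Graph) → ℕ → List (Link (V T))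
attachedSemis T k = concatMap (λ u → replicate (k ∸ deg T u) (semi u)) (allFin (nV T))

module _ (T : Graph) (k : ℕ) where

  attachedSemis-not-edgeBetween : ∀ {a b} → All (λ l → ¬ EdgeBetween l a b) (attachedSemis T k)
  attachedSemis-not-edgeBetween =
    concat⁺ (map⁺ (All.universal (λ u → replicate⁺ (k ∸ deg T u) λ ()) (allFin (nV T))))

  ^-edgeBetween⇒Adj : ∀ {h a b} → EdgeBetween (lnk (T ^⁽ k ⁾) h) a b → Adj T a b
  ^-edgeBetween⇒Adj {h} = lookup-++⁻ˡ (λ l → EdgeBetween l _ _) (links T) attachedSemis-not-edgeBetween h

  ^-edgeBetween-unique : Simple T → ∀ {h₁ h₂ a b} → EdgeBetween (lnk (T ^⁽ k ⁾) h₁) a b →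
    EdgeBetween (lnk (T ^⁽ k ⁾) h₂) a b → h₁ ≡ h₂
  ^-edgeBetween-unique (_ , unique) {h₁} {h₂} {a} {b} =
    lookup-++-unique (λ l → EdgeBetween l a b) (links T) attachedSemis-not-edgeBetween
      (λ i j → unique i j a b) h₁ h₂

module _ {T : Graph} (simple : Simple T) where

  Adj-irrefl : ∀ {a b} → Adj T a b → a ≢ b
  Adj-irrefl (i , ab) with lnk T i | proj₁ simple i | ab
  ... | _ | c , d , c≢d , refl | inj₁ (refl , refl) = c≢d
  ... | _ | c , d , c≢d , refl | inj₂ (refl , refl) = c≢d ∘ sym

  module _ (acyclic : Acyclic T) where

    no-triangle : ∀ {a b c} → Adj T a b → Adj T b c → Adj T c a → ⊥
    no-triangle {a} {b} {c} ab bc ca = acyclic 0 record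
      { c     = Vec.lookup (a ∷ b ∷ c ∷ [])
      ; inj   = λ {i} {j} → lookup-injective distinct i j
      ; adj   = λ { fz → ab ; (fs fz) → bc }
      ; close = ca
      }
      where
      distinct : Unique (a ∷ b ∷ c ∷ [])
      distinct = (Adj-irrefl ab ∷ (Adj-irrefl ca ∘ sym) ∷ [])
               ∷ (Adj-irrefl bc ∷ [])
               ∷ [] ∷ []

    no-square : ∀ {a b c d} → Adj T a b → Adj T b c → Adj T c d → Adj T d a → a ≢ c → b ≢ d → ⊥
    no-square {a} {b} {c} {d} ab bc cd da a≢c b≢d = acyclic 1 record
      { c     = Vec.lookup (a ∷ b ∷ c ∷ d ∷ [])
      ; inj   = λ {i} {j} → lookup-injective distinct i j
      ; adj   = λ { fz → ab ; (fs fz) → bc ; (fs (fs fz)) → cd }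
      ; close = da
      }
      where
      distinct : Unique (a ∷ b ∷ c ∷ d ∷ [])
      distinct = (Adj-irrefl ab ∷ a≢c ∷ (Adj-irrefl da ∘ sym) ∷ [])
               ∷ (Adj-irrefl bc ∷ b≢d ∷ [])
               ∷ (Adj-irrefl cd ∷ [])
               ∷ [] ∷ []

prev4 : Fin 4 → Fin 4
prev4 fz                = fs (fs (fs fz))
prev4 (fs fz)           = fz
prev4 (fs (fs fz))      = fs fz
prev4 (fs (fs (fs fz))) = fs (fs fz)

prev4-next4 : ∀ i → prev4 (next4 i) ≡ i
prev4-next4 fz                = refl
prev4-next4 (fs fz)           = refl
prev4-next4 (fs (fs fz))      = refl
prev4-next4 (fs (fs (fs fz))) = refl

next4-injective : ∀ {i j} → next4 i ≡ next4 j → i ≡ j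
next4-injective {i} {j} eq = begin
  i                ≡⟨ prev4-next4 i ⟨
  prev4 (next4 i)  ≡⟨ cong prev4 eq ⟩
  prev4 (next4 j)  ≡⟨ prev4-next4 j ⟩
  j                ∎
  where open ≡-Reasoning

next4-irreflexive : ∀ i → i ≢ next4 i
next4-irreflexive fz                = λ ()
next4-irreflexive (fs fz)           = λ ()
next4-irreflexive (fs (fs fz))      = λ ()
next4-irreflexive (fs (fs (fs fz))) = λ ()

rotate : ∀ {G} → C4 G → C4 G
rotate c = record
  { v     = v ∘ next4
  ; e     = e ∘ next4
  ; v-inj = next4-injective ∘ v-inj
  ; e-inj = next4-injective ∘ e-inj
  ; inc   = inc ∘ next4
  }
  where open C4 c

opposite-pair : {S : Fin 4 → Set} → (∀ i → S i ⊎ S (next4 i)) →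
  (S fz × S (fs (fs fz))) ⊎ (S (fs fz) × S (fs (fs (fs fz))))
opposite-pair cover with cover fz
opposite-pair cover | inj₁ s₀ with cover (fs (fs fz))
... | inj₁ s₂ = inj₁ (s₀ , s₂)
... | inj₂ s₃ with cover (fs fz)
...   | inj₁ s₁ = inj₂ (s₁ , s₃)
...   | inj₂ s₂ = inj₁ (s₀ , s₂)
opposite-pair cover | inj₂ s₁ with cover (fs (fs (fs fz)))
... | inj₁ s₃ = inj₂ (s₁ , s₃)
... | inj₂ s₀ with cover (fs (fs fz))
...   | inj₁ s₂ = inj₁ (s₀ , s₂)
...   | inj₂ s₃ = inj₂ (s₁ , s₃)

module _ {T : Graph} (tree : SimpleTree T) {k : ℕ} {G : Graph} (f : CoveringProjection G (T ^⁽ k ⁾)) where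
  open SimpleTree tree
  open CoveringProjection f

  private
    H : Graph
    H = T ^⁽ k ⁾

  no-backtracking : ∀ {x y z g₁ g₂} → g₁ ≢ g₂ →
    EdgeBetween (lnk G g₁) x y → EdgeBetween (lnk G g₂) y z →
    EdgeBetween (lnk H (fL g₁)) (fV x) (fV y) → EdgeBetween (lnk H (fL g₂)) (fV y) (fV z) →
    fV x ≢ fV z
  no-backtracking {x} {y} {g₁ = g₁} {g₂} g₁≢g₂ xy yz fxy fyz fx≡fz =
    g₁≢g₂ (covering-locally-injective f fy≢fx fyx refl same refl
             (edgeBetween⇒1≤ends _ (edgeBetween-sym _ xy)) (edgeBetween⇒1≤ends _ yz))
    where
    fyx : EdgeBetween (lnk H (fL g₂)) (fV y) (fV x)
    fyx = subst (EdgeBetween _ (fV y)) (sym fx≡fz) fyz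
    fy≢fx : fV y ≢ fV x
    fy≢fx = Adj-irrefl {T} simple (^-edgeBetween⇒Adj T k fyx)
    same : fL g₁ ≡ fL g₂
    same = ^-edgeBetween-unique T k simple (edgeBetween-sym _ fxy) fyx

  module Square (c : C4 G) where
    open C4 c

    w : Fin 4 → V T
    w = fV ∘ v

    SemiImage : Fin 4 → Set
    SemiImage i = IsSemi (lnk H (fL (e i)))

    ImageJoins : Fin 4 → V T → V T → Set
    ImageJoins i = EdgeBetween (lnk H (fL (e i)))

    Lifted : Fin 4 → Set
    Lifted i = ImageJoins i (w i) (w (next4 i))

    EdgeImage : Fin 4 → Set
    EdgeImage i = (SemiImage i × w i ≡ w (next4 i)) ⊎ Lifted i

    semi-or-lifted : ∀ i → EdgeImage i
    semi-or-lifted i = linkHom-edgeBetween fV _ _ (inc i) (hom (e i))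

    adj : ∀ {i a b} → ImageJoins i a b → Adj T a b
    adj = ^-edgeBetween⇒Adj T k

    lifted-path : ∀ {i} → Lifted i → Lifted (next4 i) → w i ≢ w (next4 (next4 i))
    lifted-path {i} = no-backtracking (next4-irreflexive i ∘ e-inj) (inc i) (inc (next4 i))

    no-consecutive-lifts : Lifted fz → Lifted (fs fz) → ⊥
    no-consecutive-lifts L₀ L₁ = close (semi-or-lifted (fs (fs fz))) (semi-or-lifted (fs (fs (fs fz))))
      where
      w₀≢w₂ : w fz ≢ w (fs (fs fz))
      w₀≢w₂ = lifted-path L₀ L₁
      close : EdgeImage (fs (fs fz)) → EdgeImage (fs (fs (fs fz))) → ⊥
      close (inj₁ (_ , w₂≡w₃)) (inj₁ (_ , w₃≡w₀)) = w₀≢w₂ (sym (trans w₂≡w₃ w₃≡w₀))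
      close (inj₂ L₂)          (inj₁ (_ , w₃≡w₀)) =
        no-triangle simple acyclic (adj L₀) (adj L₁)
          (adj (subst (ImageJoins (fs (fs fz)) (w (fs (fs fz)))) w₃≡w₀ L₂))
      close (inj₁ (_ , w₂≡w₃)) (inj₂ L₃)          =
        no-triangle simple acyclic (adj L₀) (adj L₁)
          (adj (subst (λ a → ImageJoins (fs (fs (fs fz))) a (w fz)) (sym w₂≡w₃) L₃))
      close (inj₂ L₂)          (inj₂ L₃)          =
        no-square simple acyclic (adj L₀) (adj L₁) (adj L₂) (adj L₃) w₀≢w₂
          (lifted-path L₁ L₂)

  open Square using (SemiImage; Lifted; semi-or-lifted; no-consecutive-lifts)

  no-consecutive-lifts-at : (c : C4 G) → ∀ i → Lifted c i → Lifted c (next4 i) → ⊥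
  no-consecutive-lifts-at c fz                = no-consecutive-lifts c
  no-consecutive-lifts-at c (fs fz)           = no-consecutive-lifts (rotate c)
  no-consecutive-lifts-at c (fs (fs fz))      = no-consecutive-lifts (rotate (rotate c))
  no-consecutive-lifts-at c (fs (fs (fs fz))) = no-consecutive-lifts (rotate (rotate (rotate c)))

  semi-image-at-consecutive : (c : C4 G) → ∀ i → SemiImage c i ⊎ SemiImage c (next4 i)
  semi-image-at-consecutive c i with semi-or-lifted c i | semi-or-lifted c (next4 i)
  ... | inj₁ (semiᵢ , _) | _                = inj₁ semiᵢ
  ... | inj₂ _          | inj₁ (semiⱼ , _) = inj₂ semiⱼ
  ... | inj₂ liftᵢ      | inj₂ liftⱼ       = ⊥-elim (no-consecutive-lifts-at c i liftᵢ liftⱼ)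

mainTheorem4 : (T : Graph) → SimpleTree T → (k : ℕ) → MaxDegreeAtMost T k →
    (G : Graph) → (f : CoveringProjection G (T ^⁽ k ⁾)) → (c : C4 G) →
    let open CoveringProjection f
        open C4 c
        isS = λ (i : Fin 4) → IsSemi (lnk (T ^⁽ k ⁾) (fL (e i)))
    in (isS fz × isS (fs (fs fz))) ⊎ (isS (fs fz) × isS (fs (fs (fs fz))))
mainTheorem4 T tree k _ G f c = opposite-pair (semi-image-at-consecutive tree f c)
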